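{- Let $v$ be any word in $\mathbf c,\mathbf d$ of non-negative degree. Then $\beta(S(v))=\beta(v)$.
   Context: $\deg\mathbf c=1$, $\deg\mathbf d=2$. For a graded poset $P$ of rank $n+1$ with minimum $\hat0$ and maximum $\hat1$, and $S\subseteq[n]$, let $f_S$ be the number of chains $\hat0<x_1<\dots<x_j<\hat1$ whose set of ranks is $S$; let $h_S=\sum_{T\subseteq S}(-1)^{|S-T|}f_T$, and $\Psi_P(\mathbf a,\mathbf b)=\sum_S h_S u_1\cdots u_n$ with $u_i=\mathbf b$ if $i\in S$ and $u_i=\mathbf a$ otherwise (non-commuting variables). For $P$ Eulerian (e.g. a Boolean lattice), this can be written uniquely as a polynomial $\Psi(P)$ in $\mathbf c=\mathbf a+\mathbf b$ and $\mathbf d=\mathbf a\mathbf b+\mathbf b\mathbf a$ (the cd-index). $B_{n+1}$ denotes the lattice of subsets of $[n+1]$. For a word $v$ in $\mathbf c,\mathbf d$ of degree $n\ge0$, $\beta(v)$ is the coefficient of $v$ in $\Psi(B_{n+1})$; also $\beta(e)=1$ for a formal symbol $e$ of degree $-1$, and $\beta$ is extended linearly to the space $\hat{\mathcal F}$ with basis $e$ and all words. Words $\mathbf c^{m_1}\mathbf d\mathbf c^{m_2}\mathbf d\cdots\mathbf d\mathbf c^{m_k}$ are encoded as lists $(m_1,\dots,m_k)$, $e$ as the empty list, and lists with a negative entry denote $0$. The linear map $S$ is defined by $S(e)=0$, $S(1)=e$, and for each nonempty list $M=(m_1,\dots,m_k)\neq(0)$: $S(M)=\sum_{i=1}^k(m_1,\dots,m_i-1,\dots,m_k)+\sum_{i=1}^{k-1}(m_1,\dots,m_{i-1},m_i+m_{i+1}+1,m_{i+2},\dots,m_k)$.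 -}

module Defs where

open import Data.Bool using (Bool; true; false; if_then_else_; _∧_; _∨_; not; _xor_)
open import Data.Nat as ℕ using (ℕ; zero; suc; _∸_; _≡ᵇ_)
open import Data.Integer as ℤ using (ℤ; +_; -_; 0ℤ; 1ℤ)
open import Data.List using (List; []; _∷_; map; _++_; concatMap)
open import Data.Vec using (Vec; []; _∷_; replicate)
open import Data.Product using (Σ; _,_; proj₁; proj₂)

sumℤ : List ℤ → ℤ
sumℤ [] = 0ℤ
sumℤ (x ∷ xs) = x ℤ.+ sumℤ xs

sumℕ : List ℕ → ℕ
sumℕ [] = 0
sumℕ (x ∷ xs) = x ℕ.+ sumℕ xs

allVecs : (m : ℕ) → List (Vec Bool m)
allVecs zero = [] ∷ []
allVecs (suc m) = concatMap (λ v → (false ∷ v) ∷ (true ∷ v) ∷ []) (allVecs m)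

card : ∀ {m} → Vec Bool m → ℕ
card [] = 0
card (true ∷ v) = suc (card v)
card (false ∷ v) = card v

_⊆ᵇ_ : ∀ {m} → Vec Bool m → Vec Bool m → Bool
[] ⊆ᵇ [] = true
(x ∷ u) ⊆ᵇ (y ∷ v) = (not x ∨ y) ∧ (u ⊆ᵇ v)

-- The Boolean lattice B_{n+1} = subsets of [n+1], graded by cardinality;
-- 0̂ = ∅, 1̂ = [n+1], rank = cardinality.

-- Number of chains prev < x_1 < ... < x_j in the subset lattice of an
-- m-set with rank(x_i) = r_i (ranks given in increasing order).
chains : ∀ {m} → Vec Bool m → List ℕ → ℕ
chains prev [] = 1
chains {m} prev (r ∷ rs) =
  sumℕ (map (λ x → if (prev ⊆ᵇ x) ∧ (card x ≡ᵇ r) then chains x rs else 0)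
            (allVecs m))

-- A subset S ⊆ [n] is encoded as a Vec Bool n (position i ↦ i ∈ S, 1-indexed).
-- ranksFrom k S lists the elements of S, the first coordinate being k.
ranksFrom : ∀ {n} → ℕ → Vec Bool n → List ℕ
ranksFrom k [] = []
ranksFrom k (true ∷ v) = k ∷ ranksFrom (suc k) v
ranksFrom k (false ∷ v) = ranksFrom (suc k) v

ranks : ∀ {n} → Vec Bool n → List ℕ
ranks = ranksFrom 1

-- flag f-vector of B_{n+1}: f_S = number of chains 0̂ < x_1 < ... < x_j < 1̂
-- with rank set S (S ⊆ [n]).
flagF : (n : ℕ) → Vec Bool n → ℕ
flagF n S = chains {suc n} (replicate (suc n) false) (ranks S)

sign : ℕ → ℤ
sign zero = 1ℤ
sign (suc k) = - sign k

flagH : (n : ℕ) → Vec Bool n → ℤ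
flagH n S =
  sumℤ (map (λ T → if T ⊆ᵇ S then sign (card S ∸ card T) ℤ.* (+ flagF n T) else 0ℤ)
            (allVecs n))

-- ab-index Ψ(B_{n+1}): an ab-word u_1⋯u_n of degree n is encoded as a
-- Vec Bool n with true = b, false = a; its coefficient is h_S where
-- S = {i : u_i = b}.
PsiB : (n : ℕ) → Vec Bool n → ℤ
PsiB n w = flagH n w

-- cd-words, indexed by degree (deg c = 1, deg d = 2), read left to right.

data CD : ℕ → Set where
  ε  : CD 0
  c· : ∀ {n} → CD n → CD (suc n)
  d· : ∀ {n} → CD n → CD (suc (suc n))

allCD : (n : ℕ) → List (CD n)
allCD zero = ε ∷ []
allCD (suc zero) = c· ε ∷ []
allCD (suc (suc n)) = map c· (allCD (suc n)) ++ map d· (allCD n)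

-- coefficient of the ab-word w in the expansion of the cd-word v
-- (c = a + b, d = ab + ba)
expandCoeff : ∀ {n} → CD n → Vec Bool n → ℤ
expandCoeff ε [] = 1ℤ
expandCoeff (c· v) (x ∷ w) = expandCoeff v w
expandCoeff (d· v) (x ∷ y ∷ w) = if x xor y then expandCoeff v w else 0ℤ

-- Φ : CD n → ℤ (a cd-polynomial of degree n, given by its coefficients)
-- is the cd-index of B_{n+1}: its ab-expansion equals Ψ(B_{n+1}).
IsCdIndexB : (n : ℕ) → (CD n → ℤ) → Set
IsCdIndexB n Φ =
  (w : Vec Bool n) → sumℤ (map (λ v → Φ v ℤ.* expandCoeff v w) (allCD n)) ≡ PsiB n w
  where open import Relation.Binary.PropositionalEquality using (_≡_)

-- List encoding: (m_1,…,m_k) ↦ c^{m_1} d c^{m_2} d ⋯ d c^{m_k};  [] ↦ e.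

cpow : ∀ {n} → (m : ℕ) → CD n → CD (m ℕ.+ n)
cpow zero v = v
cpow (suc m) v = c· (cpow m v)

wordOf : ℕ → List ℕ → Σ ℕ CD
wordOf m [] = (m ℕ.+ 0) , cpow m ε
wordOf m (m' ∷ ms) with wordOf m' ms
... | (n , v) = (m ℕ.+ suc (suc n)) , cpow m (d· v)

-- β relative to a given family Φ of cd-indices (Φ n = cd-index of B_{n+1}),
-- with β(e) = 1.
β : ((n : ℕ) → CD n → ℤ) → List ℕ → ℤ
β Φ [] = 1ℤ
β Φ (m ∷ ms) with wordOf m ms
... | (n , v) = Φ n v

-- linear extension to formal sums (lists of terms)
βsum : ((n : ℕ) → CD n → ℤ) → List (List ℕ) → ℤ
βsum Φ Ms = sumℤ (map (β Φ) Ms)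

-- The operator S. Terms with a negative entry (= 0) are omitted.

decs : List ℕ → List (List ℕ)
decs [] = []
decs (zero ∷ ms) = map (zero ∷_) (decs ms)
decs (suc m ∷ ms) = (m ∷ ms) ∷ map (suc m ∷_) (decs ms)

merges : List ℕ → List (List ℕ)
merges [] = []
merges (m ∷ []) = []
merges (m ∷ m' ∷ ms) = (m ℕ.+ m' ℕ.+ 1 ∷ ms) ∷ map (m ∷_) (merges (m' ∷ ms))

Sop : List ℕ → List (List ℕ)
Sop [] = []
Sop (zero ∷ []) = [] ∷ []
Sop M = decs M ++ merges M

-- The cd-index of Boolean lattices satisfies Ψ(B_{n+2}) = Ψ(B_{n+1}) c + G Ψ(B_{n+1}), where G is the
-- derivation with G c = d and G d = c d. The operator S is the transpose of u ↦ u c + G u in the basis of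
-- cd-words: lowering the last exponent removes the final c, lowering an inner exponent undoes G d = c d,
-- and merging two neighbouring runs undoes G c = d. Hence β(S v) is the coefficient of v in
-- Ψ(B_{n+1}) c + G Ψ(B_{n+1}), which is β(v); for the word 1, β(S 1) = β(e) = 1 = β(1).
--
-- The recursion is first proved for flag f-vectors, read as ab-polynomials: sorting the chains of B_{n+2}
-- by the step at which a fixed atom enters gives f(B_{n+2}) = c f + f b + D f for f = f(B_{n+1}), with D
-- the derivation a ↦ 0, b ↦ b c. The substitution a ↦ a − b turns flag f-vectors into flag h-vectors and this recursion
-- into Ψ(B_{n+2}) = a Ψ + Ψ b + D′ Ψ with D′ a = D′ b = b a, which is Ψ c + G Ψ. It passes to cd-indices
-- because expanding c = a + b and d = ab + ba is injective.

module Submission where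

open import Defs
open import Data.Bool using (Bool; true; false; if_then_else_; _∧_; _∨_; not; _xor_; T)
open import Data.Bool.Properties using (∧-zeroʳ; ∨-zeroʳ)
open import Data.Nat as ℕ using (ℕ; zero; suc; _≤_; z≤n; s≤s; _≡ᵇ_; _∸_)
import Data.Nat.Properties as ℕₚ
import Data.Integer.Properties as ℤₚ
open import Algebra.Properties.CommutativeSemigroup ℤₚ.+-commutativeSemigroup
  using (x∙yz≈y∙xz; x∙yz≈xz∙y; interchange)
open import Algebra.Properties.CommutativeSemigroup ℕₚ.+-commutativeSemigroup
  using () renaming (interchange to ℕ-+-interchange)
open import Data.Integer as ℤ using (ℤ; 0ℤ; _+_; _-_; -_; _*_)
open import Data.Integer.Tactic.RingSolver using (solve-∀)
open import Data.List using (List; []; _∷_; map; _++_; concatMap)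
open import Data.List.Properties using (map-cong; map-∘; map-++)
open import Data.Vec using (Vec; []; _∷_; replicate; tail; init; last)
open import Data.Product using (Σ; _,_; proj₁; proj₂; uncurry)
open import Function using (_∘_)
open import Algebra.Properties.AbelianGroup ℤₚ.+-0-abelianGroup using (∙-cancelˡ)
open import Relation.Nullary using (contradiction)
open import Relation.Binary.PropositionalEquality
open ≡-Reasoning

private variable
  A B : Set
  m n : ℕ

sumℕ-zeros : (xs : List A) → sumℕ (map (λ _ → 0) xs) ≡ 0
sumℕ-zeros [] = refl
sumℕ-zeros (_ ∷ xs) = sumℕ-zeros xs

sumℕ-+ : (f g : A → ℕ) (xs : List A) →
         sumℕ (map (λ x → f x ℕ.+ g x) xs) ≡ sumℕ (map f xs) ℕ.+ sumℕ (map g xs)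
sumℕ-+ f g [] = refl
sumℕ-+ f g (x ∷ xs) = trans (cong (f x ℕ.+ g x ℕ.+_) (sumℕ-+ f g xs))
                            (ℕ-+-interchange (f x) (g x) (sumℕ (map f xs)) (sumℕ (map g xs)))

sumℕ-swap : (h : A → B → ℕ) (xs : List A) (ys : List B) →
            sumℕ (map (λ x → sumℕ (map (h x) ys)) xs) ≡ sumℕ (map (λ y → sumℕ (map (λ x → h x y) xs)) ys)
sumℕ-swap h [] ys = sym (sumℕ-zeros ys)
sumℕ-swap h (x ∷ xs) ys =
  trans (cong (sumℕ (map (h x) ys) ℕ.+_) (sumℕ-swap h xs ys)) (sym (sumℕ-+ (h x) _ ys))

if-sumℕ : (b : Bool) (f : A → ℕ) (xs : List A) →
          (if b then sumℕ (map f xs) else 0) ≡ sumℕ (map (λ x → if b then f x else 0) xs)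
if-sumℕ true f xs = refl
if-sumℕ false f xs = sym (sumℕ-zeros xs)

sumℕ-allVecs : (g : Vec Bool (suc m) → ℕ) →
  sumℕ (map g (allVecs (suc m))) ≡ sumℕ (map (λ v → g (false ∷ v) ℕ.+ g (true ∷ v)) (allVecs m))
sumℕ-allVecs {m} g = go (allVecs m)
  where
  go : (vs : List (Vec Bool m)) →
       sumℕ (map g (concatMap (λ v → (false ∷ v) ∷ (true ∷ v) ∷ []) vs))
         ≡ sumℕ (map (λ v → g (false ∷ v) ℕ.+ g (true ∷ v)) vs)
  go [] = refl
  go (v ∷ vs) = trans (sym (ℕₚ.+-assoc (g (false ∷ v)) (g (true ∷ v)) _))
                      (cong (g (false ∷ v) ℕ.+ g (true ∷ v) ℕ.+_) (go vs))

sumℤ-zeros : (xs : List A) → sumℤ (map (λ _ → 0ℤ) xs) ≡ 0ℤ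
sumℤ-zeros [] = refl
sumℤ-zeros (_ ∷ xs) = cong (0ℤ +_) (sumℤ-zeros xs)

sumℤ-+ : (f g : A → ℤ) (xs : List A) →
         sumℤ (map (λ x → f x + g x) xs) ≡ sumℤ (map f xs) + sumℤ (map g xs)
sumℤ-+ f g [] = refl
sumℤ-+ f g (x ∷ xs) = trans (cong (f x + g x +_) (sumℤ-+ f g xs))
                            (interchange (f x) (g x) (sumℤ (map f xs)) (sumℤ (map g xs)))

sumℤ-neg : (f : A → ℤ) (xs : List A) → sumℤ (map (λ x → - f x) xs) ≡ - sumℤ (map f xs)
sumℤ-neg f [] = refl
sumℤ-neg f (x ∷ xs) = trans (cong (- f x +_) (sumℤ-neg f xs)) (sym (ℤₚ.neg-distrib-+ (f x) (sumℤ (map f xs))))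

sumℤ-++ : (xs ys : List ℤ) → sumℤ (xs ++ ys) ≡ sumℤ xs + sumℤ ys
sumℤ-++ [] ys = sym (ℤₚ.+-identityˡ (sumℤ ys))
sumℤ-++ (x ∷ xs) ys = trans (cong (x +_) (sumℤ-++ xs ys)) (sym (ℤₚ.+-assoc x (sumℤ xs) (sumℤ ys)))

sumℤ-allVecs : (g : Vec Bool (suc m) → ℤ) →
  sumℤ (map g (allVecs (suc m))) ≡ sumℤ (map (λ v → g (false ∷ v) + g (true ∷ v)) (allVecs m))
sumℤ-allVecs {m} g = go (allVecs m)
  where
  go : (vs : List (Vec Bool m)) →
       sumℤ (map g (concatMap (λ v → (false ∷ v) ∷ (true ∷ v) ∷ []) vs))
         ≡ sumℤ (map (λ v → g (false ∷ v) + g (true ∷ v)) vs)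
  go [] = refl
  go (v ∷ vs) = trans (sym (ℤₚ.+-assoc (g (false ∷ v)) (g (true ∷ v)) _))
                      (cong (g (false ∷ v) + g (true ∷ v) +_) (go vs))

pos-sumℕ : (f : A → ℕ) (xs : List A) → ℤ.+ sumℕ (map f xs) ≡ sumℤ (map (ℤ.+_ ∘ f) xs)
pos-sumℕ f [] = refl
pos-sumℕ f (x ∷ xs) = trans (ℤₚ.pos-+ (f x) (sumℕ (map f xs))) (cong (λ s → ℤ.+ f x + s) (pos-sumℕ f xs))

if-same : (b : Bool) {x : A} → (if b then x else x) ≡ x
if-same false = refl
if-same true = refl

if-+ : (b : Bool) (u v : ℤ) → (if b then u + v else 0ℤ) ≡ (if b then u else 0ℤ) + (if b then v else 0ℤ)
if-+ false u v = refl
if-+ true u v = refl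

-- Chains in the Boolean lattice

card-≤ : (v : Vec Bool n) → card v ≤ n
card-≤ [] = z≤n
card-≤ (true ∷ v) = s≤s (card-≤ v)
card-≤ (false ∷ v) = ℕₚ.m≤n⇒m≤1+n (card-≤ v)

⊆ᵇ⇒card-≤ : (p x : Vec Bool n) → (p ⊆ᵇ x) ≡ true → card p ≤ card x
⊆ᵇ⇒card-≤ [] [] _ = z≤n
⊆ᵇ⇒card-≤ (true ∷ p) (true ∷ x) p⊆x = s≤s (⊆ᵇ⇒card-≤ p x p⊆x)
⊆ᵇ⇒card-≤ (false ∷ p) (true ∷ x) p⊆x = ℕₚ.m≤n⇒m≤1+n (⊆ᵇ⇒card-≤ p x p⊆x)
⊆ᵇ⇒card-≤ (false ∷ p) (false ∷ x) p⊆x = ⊆ᵇ⇒card-≤ p x p⊆x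

≢⇒≡ᵇ-false : (i j : ℕ) → i ≢ j → (i ≡ᵇ j) ≡ false
≢⇒≡ᵇ-false i j i≢j with i ≡ᵇ j in eq
... | false = refl
... | true = contradiction (ℕₚ.≡ᵇ⇒≡ i j (subst T (sym eq) _)) i≢j

onRankAbove : Vec Bool m → ℕ → (Vec Bool m → ℕ) → Vec Bool m → ℕ
onRankAbove p r F x = if (p ⊆ᵇ x) ∧ (card x ≡ᵇ r) then F x else 0

sumAbove : Vec Bool m → ℕ → (Vec Bool m → ℕ) → ℕ
sumAbove {m} p r F = sumℕ (map (onRankAbove p r F) (allVecs m))

sumAbove-cong : (p : Vec Bool m) (r : ℕ) {F F′ : Vec Bool m → ℕ} →
                (∀ x → card x ≡ r → F x ≡ F′ x) → sumAbove p r F ≡ sumAbove p r F′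
sumAbove-cong {m} p r {F} {F′} F≡F′ = cong sumℕ (map-cong summand (allVecs m))
  where
  summand : onRankAbove p r F ≗ onRankAbove p r F′
  summand x with p ⊆ᵇ x | card x ≡ᵇ r in card≡ᵇr
  ... | false | _ = refl
  ... | true | false = refl
  ... | true | true = F≡F′ x (ℕₚ.≡ᵇ⇒≡ (card x) r (subst T (sym card≡ᵇr) _))

sumAbove-true∷ : (p : Vec Bool m) (r : ℕ) (F : Vec Bool (suc m) → ℕ) →
                 sumAbove (true ∷ p) (suc r) F ≡ sumAbove p r (F ∘ (true ∷_))
sumAbove-true∷ p r F = sumℕ-allVecs (onRankAbove (true ∷ p) (suc r) F)

sumAbove-false∷ : (p : Vec Bool m) (r : ℕ) (F : Vec Bool (suc m) → ℕ) →
                  sumAbove (false ∷ p) (suc r) F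
                    ≡ sumAbove p (suc r) (F ∘ (false ∷_)) ℕ.+ sumAbove p r (F ∘ (true ∷_))
sumAbove-false∷ {m} p r F =
  trans (sumℕ-allVecs (onRankAbove (false ∷ p) (suc r) F))
        (sumℕ-+ (onRankAbove p (suc r) (F ∘ (false ∷_))) (onRankAbove p r (F ∘ (true ∷_))) (allVecs m))

sumAbove-sumℕ : (p : Vec Bool m) (r : ℕ) (g : Vec Bool m → A → ℕ) (ys : List A) →
                sumAbove p r (λ x → sumℕ (map (g x) ys)) ≡ sumℕ (map (λ y → sumAbove p r (λ x → g x y)) ys)
sumAbove-sumℕ {m} p r g ys = begin
  sumAbove p r (λ x → sumℕ (map (g x) ys))
    ≡⟨ cong sumℕ (map-cong (λ x → if-sumℕ ((p ⊆ᵇ x) ∧ (card x ≡ᵇ r)) (g x) ys) (allVecs m)) ⟩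
  sumℕ (map (λ x → sumℕ (map (λ y → onRankAbove p r (λ x → g x y) x) ys)) (allVecs m))
    ≡⟨ sumℕ-swap (λ x y → onRankAbove p r (λ x → g x y) x) (allVecs m) ys ⟩
  sumℕ (map (λ y → sumAbove p r (λ x → g x y)) ys) ∎

sumAbove-card : (p : Vec Bool m) (F : Vec Bool m → ℕ) → sumAbove p (card p) F ≡ F p
sumAbove-card [] F = ℕₚ.+-identityʳ (F [])
sumAbove-card (true ∷ p) F = trans (sumAbove-true∷ p (card p) F) (sumAbove-card p (F ∘ (true ∷_)))
sumAbove-card {suc m} (false ∷ p) F = begin
  sumAbove (false ∷ p) (card p) F
    ≡⟨ sumℕ-allVecs (onRankAbove (false ∷ p) (card p) F) ⟩
  sumℕ (map (λ v → summand v ℕ.+ (if (p ⊆ᵇ v) ∧ (suc (card v) ≡ᵇ card p) then F (true ∷ v) else 0)) (allVecs m))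
    ≡⟨ cong sumℕ (map-cong no-larger (allVecs m)) ⟩
  sumℕ (map summand (allVecs m))
    ≡⟨ sumAbove-card p (F ∘ (false ∷_)) ⟩
  F (false ∷ p) ∎
  where
  summand : Vec Bool m → ℕ
  summand v = if (p ⊆ᵇ v) ∧ (card v ≡ᵇ card p) then F (false ∷ v) else 0
  no-larger : ∀ v → summand v ℕ.+ (if (p ⊆ᵇ v) ∧ (suc (card v) ≡ᵇ card p) then F (true ∷ v) else 0) ≡ summand v
  no-larger v with p ⊆ᵇ v in p⊆v
  ... | false = refl
  ... | true rewrite ≢⇒≡ᵇ-false (suc (card v)) (card p)
                       (λ e → ℕₚ.<⇒≱ (ℕₚ.≤-reflexive e) (⊆ᵇ⇒card-≤ p v p⊆v)) = ℕₚ.+-identityʳ _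

sumAbove-top : (p : Vec Bool m) (F : Vec Bool m → ℕ) → sumAbove p m F ≡ F (replicate m true)
sumAbove-top [] F = ℕₚ.+-identityʳ (F [])
sumAbove-top {suc m} (x ∷ p) F = begin
  sumAbove (x ∷ p) (suc m) F
    ≡⟨ sumℕ-allVecs (onRankAbove (x ∷ p) (suc m) F) ⟩
  sumℕ (map (λ v → (if ((not x ∨ false) ∧ (p ⊆ᵇ v)) ∧ (card v ≡ᵇ suc m) then F (false ∷ v) else 0)
                   ℕ.+ (if ((not x ∨ true) ∧ (p ⊆ᵇ v)) ∧ (card v ≡ᵇ m) then F (true ∷ v) else 0))
            (allVecs m))
    ≡⟨ cong sumℕ (map-cong only-full (allVecs m)) ⟩
  sumAbove p m (F ∘ (true ∷_))
    ≡⟨ sumAbove-top p (F ∘ (true ∷_)) ⟩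
  F (replicate (suc m) true) ∎
  where
  only-full : ∀ v → (if ((not x ∨ false) ∧ (p ⊆ᵇ v)) ∧ (card v ≡ᵇ suc m) then F (false ∷ v) else 0)
                    ℕ.+ (if ((not x ∨ true) ∧ (p ⊆ᵇ v)) ∧ (card v ≡ᵇ m) then F (true ∷ v) else 0)
                  ≡ (if (p ⊆ᵇ v) ∧ (card v ≡ᵇ m) then F (true ∷ v) else 0)
  only-full v rewrite ≢⇒≡ᵇ-false (card v) (suc m) (λ e → ℕₚ.<⇒≱ (ℕₚ.≤-reflexive (sym e)) (card-≤ v))
                    | ∧-zeroʳ ((not x ∨ false) ∧ (p ⊆ᵇ v))
                    | ∨-zeroʳ (not x) = refl

chains-card∷ : (p : Vec Bool m) (rs : List ℕ) → chains p (card p ∷ rs) ≡ chains p rs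
chains-card∷ p rs = sumAbove-card p (λ x → chains x rs)

chains-dedup : (p : Vec Bool m) (pre : List ℕ) (r : ℕ) (rs : List ℕ) →
               chains p (pre ++ r ∷ r ∷ rs) ≡ chains p (pre ++ r ∷ rs)
chains-dedup p [] r rs =
  sumAbove-cong p r (λ x card≡r → trans (cong (λ q → chains x (q ∷ rs)) (sym card≡r)) (chains-card∷ x rs))
chains-dedup p (q ∷ pre) r rs = sumAbove-cong p q (λ x _ → chains-dedup x pre r rs)

chains-top : (p : Vec Bool m) (pre : List ℕ) → chains p (pre ++ m ∷ []) ≡ chains p pre
chains-top p [] = sumAbove-top p (λ _ → 1)
chains-top p (q ∷ pre) = sumAbove-cong p q (λ x _ → chains-top x pre)

chains-true∷ : (p : Vec Bool m) (qs : List ℕ) → chains (true ∷ p) (map suc qs) ≡ chains p qs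
chains-true∷ p [] = refl
chains-true∷ p (q ∷ qs) =
  trans (sumAbove-true∷ p q (λ x → chains x (map suc qs))) (sumAbove-cong p q (λ x _ → chains-true∷ x qs))

raisedPrefixes : List ℕ → List (List ℕ)
raisedPrefixes [] = []
raisedPrefixes (q ∷ qs) = map (suc q ∷_) (qs ∷ raisedPrefixes qs)

-- A chain above false ∷ p is a chain above p together with the step at which the new atom enters;
-- the ranks before that step are one higher inside p.
chains-false∷ : (p : Vec Bool m) (qs : List ℕ) →
                chains (false ∷ p) (map suc qs) ≡ sumℕ (map (chains p) (qs ∷ raisedPrefixes qs))
chains-false∷ p [] = refl
chains-false∷ p (q ∷ qs) = begin
  chains (false ∷ p) (map suc (q ∷ qs))
    ≡⟨ sumAbove-false∷ p q (λ x → chains x (map suc qs)) ⟩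
  sumAbove p (suc q) (λ v → chains (false ∷ v) (map suc qs)) ℕ.+ sumAbove p q (λ v → chains (true ∷ v) (map suc qs))
    ≡⟨ cong₂ ℕ._+_ (sumAbove-cong p (suc q) (λ v _ → chains-false∷ v qs))
                   (sumAbove-cong p q (λ v _ → chains-true∷ v qs)) ⟩
  sumAbove p (suc q) (λ v → sumℕ (map (chains v) bumped)) ℕ.+ chains p (q ∷ qs)
    ≡⟨ cong (ℕ._+ chains p (q ∷ qs)) (sumAbove-sumℕ p (suc q) chains bumped) ⟩
  sumℕ (map (λ l → chains p (suc q ∷ l)) bumped) ℕ.+ chains p (q ∷ qs)
    ≡⟨ ℕₚ.+-comm _ (chains p (q ∷ qs)) ⟩
  chains p (q ∷ qs) ℕ.+ sumℕ (map (λ l → chains p (suc q ∷ l)) bumped)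
    ≡⟨ cong (λ s → chains p (q ∷ qs) ℕ.+ sumℕ s) (map-∘ bumped) ⟩
  sumℕ (map (chains p) ((q ∷ qs) ∷ raisedPrefixes (q ∷ qs))) ∎
  where
  bumped : List (List ℕ)
  bumped = qs ∷ raisedPrefixes qs

-- Flag vectors and the ab-index

-- A function P : Vec Bool n → ℤ stands for the ab-polynomial Σ_w P w · w, with false = a and true = b.

a·_ : (Vec Bool n → ℤ) → Vec Bool (suc n) → ℤ
(a· P) (x ∷ w) = if x then 0ℤ else P w

_·b : (Vec Bool n → ℤ) → Vec Bool (suc n) → ℤ
(P ·b) w = if last w then P (init w) else 0ℤ

-- the derivation with a ↦ 0 and b ↦ b c
Dbc : (Vec Bool n → ℤ) → Vec Bool (suc n) → ℤ
Dbc {zero} P (_ ∷ []) = 0ℤ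
Dbc {suc n} P (x ∷ y ∷ w) = (if x then P (true ∷ w) else 0ℤ) + Dbc (P ∘ (x ∷_)) (y ∷ w)

-- the derivation with a ↦ b a and b ↦ b a
Dba : (Vec Bool n → ℤ) → Vec Bool (suc n) → ℤ
Dba {zero} P (_ ∷ []) = 0ℤ
Dba {suc n} P (x ∷ y ∷ w) = (if x ∧ not y then P (false ∷ w) + P (true ∷ w) else 0ℤ) + Dba (P ∘ (x ∷_)) (y ∷ w)

-- the derivation with a ↦ b a and b ↦ a b, i.e. G on ab-polynomials
Gab : (Vec Bool n → ℤ) → Vec Bool (suc n) → ℤ
Gab {zero} P (_ ∷ []) = 0ℤ
Gab {suc n} P (x ∷ y ∷ w) = (if x xor y then P (y ∷ w) else 0ℤ) + Gab (P ∘ (x ∷_)) (y ∷ w)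

Dba-- : (P Q : Vec Bool n → ℤ) (w : Vec Bool (suc n)) → Dba (λ v → P v - Q v) w ≡ Dba P w - Dba Q w
Dba-- {zero} P Q (_ ∷ []) = refl
Dba-- {suc n} P Q (x ∷ y ∷ w) =
  trans (cong₂ _+_ (head-term (x ∧ not y)) (Dba-- (P ∘ (x ∷_)) (Q ∘ (x ∷_)) (y ∷ w)))
        (sub-interchange (if x ∧ not y then P (false ∷ w) + P (true ∷ w) else 0ℤ)
                         (if x ∧ not y then Q (false ∷ w) + Q (true ∷ w) else 0ℤ)
                         (Dba (P ∘ (x ∷_)) (y ∷ w)) (Dba (Q ∘ (x ∷_)) (y ∷ w)))
  where
  sub-interchange : ∀ a b c d → (a - b) + (c - d) ≡ (a + c) - (b + d)
  sub-interchange = solve-∀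
  head-term : ∀ b → (if b then (P (false ∷ w) - Q (false ∷ w)) + (P (true ∷ w) - Q (true ∷ w)) else 0ℤ)
              ≡ (if b then P (false ∷ w) + P (true ∷ w) else 0ℤ) - (if b then Q (false ∷ w) + Q (true ∷ w) else 0ℤ)
  head-term false = refl
  head-term true = sub-interchange (P (false ∷ w)) (Q (false ∷ w)) (P (true ∷ w)) (Q (true ∷ w))

Gab-cong : {P Q : Vec Bool n → ℤ} → P ≗ Q → Gab P ≗ Gab Q
Gab-cong {zero} P≡Q (_ ∷ []) = refl
Gab-cong {suc n} P≡Q (x ∷ y ∷ w) =
  cong₂ _+_ (cong (λ e → if x xor y then e else 0ℤ) (P≡Q (y ∷ w))) (Gab-cong (P≡Q ∘ (x ∷_)) (y ∷ w))

Gab-+ : (P Q : Vec Bool n → ℤ) (w : Vec Bool (suc n)) → Gab (λ v → P v + Q v) w ≡ Gab P w + Gab Q w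
Gab-+ {zero} P Q (_ ∷ []) = refl
Gab-+ {suc n} P Q (x ∷ y ∷ w) =
  trans (cong₂ _+_ (if-+ (x xor y) (P (y ∷ w)) (Q (y ∷ w))) (Gab-+ (P ∘ (x ∷_)) (Q ∘ (x ∷_)) (y ∷ w)))
        (interchange (if x xor y then P (y ∷ w) else 0ℤ) (if x xor y then Q (y ∷ w) else 0ℤ)
                     (Gab (P ∘ (x ∷_)) (y ∷ w)) (Gab (Q ∘ (x ∷_)) (y ∷ w)))

Gab-zero : (w : Vec Bool (suc n)) → Gab (λ _ → 0ℤ) w ≡ 0ℤ
Gab-zero {zero} (_ ∷ []) = refl
Gab-zero {suc n} (x ∷ y ∷ w) =
  trans (cong (_+ Gab (λ _ → 0ℤ) (y ∷ w)) (if-same (x xor y))) (trans (ℤₚ.+-identityˡ _) (Gab-zero (y ∷ w)))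

Gab-if : (b : Bool) (P : Vec Bool n → ℤ) (w : Vec Bool (suc n)) →
         Gab (λ v → if b then P v else 0ℤ) w ≡ (if b then Gab P w else 0ℤ)
Gab-if false P w = Gab-zero w
Gab-if true P w = refl

sum-raisedPrefixes : (f : List ℕ → ℤ) (N : ℕ) →
  (∀ pre r rs → f (pre ++ r ∷ r ∷ rs) ≡ f (pre ++ r ∷ rs)) →
  (∀ pre → f (pre ++ N ∷ []) ≡ f pre) →
  (j : ℕ) (S : Vec Bool (suc n)) → suc j ℕ.+ n ≡ N →
  sumℤ (map f (raisedPrefixes (ranksFrom j S)))
    ≡ ((f ∘ ranksFrom (suc j)) ·b) S + Dbc (f ∘ ranksFrom (suc j)) S
sum-raisedPrefixes {zero} f N dedup top j (false ∷ []) _ = refl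
sum-raisedPrefixes {zero} f N dedup top j (true ∷ []) j+1≡N =
  cong (_+ 0ℤ) (trans (cong (λ r → f (r ∷ [])) (trans (sym (ℕₚ.+-identityʳ (suc j))) j+1≡N)) (top []))
sum-raisedPrefixes {suc n} f N dedup top j (false ∷ y ∷ w) j+n+2≡N =
  trans (sum-raisedPrefixes f N dedup top (suc j) (y ∷ w) (trans (cong suc (sym (ℕₚ.+-suc j n))) j+n+2≡N))
        (cong (((F ∘ (false ∷_)) ·b) (y ∷ w) +_) (sym (ℤₚ.+-identityˡ (Dbc (F ∘ (false ∷_)) (y ∷ w)))))
  where
  F : Vec Bool (suc n) → ℤ
  F = f ∘ ranksFrom (suc j)
sum-raisedPrefixes {suc n} f N dedup top j (true ∷ y ∷ w) j+n+2≡N = begin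
  f (suc j ∷ rs) + sumℤ (map f (map (suc j ∷_) (raisedPrefixes rs)))
    ≡⟨ cong₂ _+_ (collapse y) (cong sumℤ (sym (map-∘ (raisedPrefixes rs)))) ⟩
  F (true ∷ w) + sumℤ (map (f ∘ (suc j ∷_)) (raisedPrefixes rs))
    ≡⟨ cong (F (true ∷ w) +_)
         (sum-raisedPrefixes (f ∘ (suc j ∷_)) N (λ pre → dedup (suc j ∷ pre)) (λ pre → top (suc j ∷ pre))
                             (suc j) (y ∷ w) (trans (cong suc (sym (ℕₚ.+-suc j n))) j+n+2≡N)) ⟩
  F (true ∷ w) + (((F ∘ (true ∷_)) ·b) (y ∷ w) + Dbc (F ∘ (true ∷_)) (y ∷ w))
    ≡⟨ x∙yz≈y∙xz (F (true ∷ w)) (((F ∘ (true ∷_)) ·b) (y ∷ w)) (Dbc (F ∘ (true ∷_)) (y ∷ w)) ⟩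
  (F ·b) (true ∷ y ∷ w) + Dbc F (true ∷ y ∷ w) ∎
  where
  F : Vec Bool (suc n) → ℤ
  F = f ∘ ranksFrom (suc j)
  rs : List ℕ
  rs = ranksFrom (suc j) (y ∷ w)
  collapse : ∀ y → f (suc j ∷ ranksFrom (suc j) (y ∷ w)) ≡ F (true ∷ w)
  collapse false = refl
  collapse true = dedup [] (suc j) (ranksFrom (suc (suc j)) w)

ranksFrom-suc : (k : ℕ) (S : Vec Bool n) → ranksFrom (suc k) S ≡ map suc (ranksFrom k S)
ranksFrom-suc k [] = refl
ranksFrom-suc k (true ∷ S) = cong (suc k ∷_) (ranksFrom-suc (suc k) S)
ranksFrom-suc k (false ∷ S) = ranksFrom-suc (suc k) S

card-replicate-false : (m : ℕ) → card (replicate m false) ≡ 0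
card-replicate-false zero = refl
card-replicate-false (suc m) = card-replicate-false m

flagF-suc : (n : ℕ) (S : Vec Bool (suc n)) → let F = ℤ.+_ ∘ flagF n in
            ℤ.+ flagF (suc n) S ≡ F (tail S) + (F ·b) S + Dbc F S
flagF-suc n (x ∷ S) = begin
  ℤ.+ chains (false ∷ ∅) (ranksFrom 1 (x ∷ S))
    ≡⟨ cong (λ qs → ℤ.+ chains (false ∷ ∅) qs) (ranksFrom-suc 0 (x ∷ S)) ⟩
  ℤ.+ chains (false ∷ ∅) (map suc rs)
    ≡⟨ cong ℤ.+_ (chains-false∷ ∅ rs) ⟩
  ℤ.+ sumℕ (map (chains ∅) (rs ∷ raisedPrefixes rs))
    ≡⟨ pos-sumℕ (chains ∅) (rs ∷ raisedPrefixes rs) ⟩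
  f rs + sumℤ (map f (raisedPrefixes rs))
    ≡⟨ cong₂ _+_ (cong ℤ.+_ (start x))
                 (sum-raisedPrefixes f (suc n) (λ pre r l → cong ℤ.+_ (chains-dedup ∅ pre r l))
                                     (λ pre → cong ℤ.+_ (chains-top ∅ pre)) 0 (x ∷ S) refl) ⟩
  F S + ((F ·b) (x ∷ S) + Dbc F (x ∷ S))
    ≡⟨ sym (ℤₚ.+-assoc (F S) ((F ·b) (x ∷ S)) (Dbc F (x ∷ S))) ⟩
  F S + (F ·b) (x ∷ S) + Dbc F (x ∷ S) ∎
  where
  ∅ : Vec Bool (suc n)
  ∅ = replicate (suc n) false
  rs : List ℕ
  rs = ranksFrom 0 (x ∷ S)
  f : List ℕ → ℤ
  f = ℤ.+_ ∘ chains ∅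
  F : Vec Bool n → ℤ
  F = ℤ.+_ ∘ flagF n
  start : ∀ x → chains ∅ (ranksFrom 0 (x ∷ S)) ≡ flagF n S
  start false = refl
  start true = trans (cong (λ r → chains ∅ (r ∷ ranks S)) (sym (card-replicate-false (suc n))))
                     (chains-card∷ ∅ (ranks S))

-- the substitution a ↦ a − b, b ↦ b
toH : (Vec Bool n → ℤ) → Vec Bool n → ℤ
toH F [] = F []
toH F (false ∷ w) = toH (F ∘ (false ∷_)) w
toH F (true ∷ w) = toH (F ∘ (true ∷_)) w - toH (F ∘ (false ∷_)) w

alternatingTerm : (Vec Bool n → ℤ) → Vec Bool n → Vec Bool n → ℤ
alternatingTerm F S T = if T ⊆ᵇ S then sign (card S ∸ card T) * F T else 0ℤ

alternatingSum≡toH : (F : Vec Bool n → ℤ) (S : Vec Bool n) →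
                     sumℤ (map (alternatingTerm F S) (allVecs n)) ≡ toH F S
alternatingSum≡toH F [] = trans (ℤₚ.+-identityʳ _) (ℤₚ.*-identityˡ (F []))
alternatingSum≡toH {suc n} F (false ∷ S) = begin
  sumℤ (map (alternatingTerm F (false ∷ S)) (allVecs (suc n)))
    ≡⟨ sumℤ-allVecs (alternatingTerm F (false ∷ S)) ⟩
  sumℤ (map (λ v → alternatingTerm (F ∘ (false ∷_)) S v + 0ℤ) (allVecs n))
    ≡⟨ cong sumℤ (map-cong (λ v → ℤₚ.+-identityʳ _) (allVecs n)) ⟩
  sumℤ (map (alternatingTerm (F ∘ (false ∷_)) S) (allVecs n))
    ≡⟨ alternatingSum≡toH (F ∘ (false ∷_)) S ⟩
  toH F (false ∷ S) ∎
alternatingSum≡toH {suc n} F (true ∷ S) = begin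
  sumℤ (map (alternatingTerm F (true ∷ S)) (allVecs (suc n)))
    ≡⟨ sumℤ-allVecs (alternatingTerm F (true ∷ S)) ⟩
  sumℤ (map (λ v → alternatingTerm F (true ∷ S) (false ∷ v) + t₁ v) (allVecs n))
    ≡⟨ cong sumℤ (map-cong (λ v → cong (_+ t₁ v) (sign-flip v)) (allVecs n)) ⟩
  sumℤ (map (λ v → - t₀ v + t₁ v) (allVecs n))
    ≡⟨ sumℤ-+ (λ v → - t₀ v) t₁ (allVecs n) ⟩
  sumℤ (map (λ v → - t₀ v) (allVecs n)) + sumℤ (map t₁ (allVecs n))
    ≡⟨ cong (_+ sumℤ (map t₁ (allVecs n))) (sumℤ-neg t₀ (allVecs n)) ⟩
  - sumℤ (map t₀ (allVecs n)) + sumℤ (map t₁ (allVecs n))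
    ≡⟨ cong₂ (λ a b → - a + b) (alternatingSum≡toH (F ∘ (false ∷_)) S)
                               (alternatingSum≡toH (F ∘ (true ∷_)) S) ⟩
  - toH (F ∘ (false ∷_)) S + toH (F ∘ (true ∷_)) S
    ≡⟨ ℤₚ.+-comm (- toH (F ∘ (false ∷_)) S) (toH (F ∘ (true ∷_)) S) ⟩
  toH F (true ∷ S) ∎
  where
  t₀ t₁ : Vec Bool n → ℤ
  t₀ = alternatingTerm (F ∘ (false ∷_)) S
  t₁ = alternatingTerm (F ∘ (true ∷_)) S
  sign-flip : ∀ v → alternatingTerm F (true ∷ S) (false ∷ v) ≡ - t₀ v
  sign-flip v with v ⊆ᵇ S in v⊆S
  ... | false = refl
  ... | true = begin
    sign (suc (card S) ∸ card v) * F (false ∷ v)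
      ≡⟨ cong (λ k → sign k * F (false ∷ v)) (ℕₚ.+-∸-assoc 1 (⊆ᵇ⇒card-≤ v S v⊆S)) ⟩
    - sign (card S ∸ card v) * F (false ∷ v)
      ≡⟨ sym (ℤₚ.neg-distribˡ-* (sign (card S ∸ card v)) (F (false ∷ v))) ⟩
    - (sign (card S ∸ card v) * F (false ∷ v)) ∎

toH-cong : {F F′ : Vec Bool n → ℤ} → F ≗ F′ → toH F ≗ toH F′
toH-cong F≡F′ [] = F≡F′ []
toH-cong F≡F′ (false ∷ w) = toH-cong (F≡F′ ∘ (false ∷_)) w
toH-cong F≡F′ (true ∷ w) = cong₂ _-_ (toH-cong (F≡F′ ∘ (true ∷_)) w) (toH-cong (F≡F′ ∘ (false ∷_)) w)

toH-+ : (F F′ : Vec Bool n → ℤ) (w : Vec Bool n) → toH (λ v → F v + F′ v) w ≡ toH F w + toH F′ w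
toH-+ F F′ [] = refl
toH-+ F F′ (false ∷ w) = toH-+ (F ∘ (false ∷_)) (F′ ∘ (false ∷_)) w
toH-+ F F′ (true ∷ w) =
  trans (cong₂ _-_ (toH-+ (F ∘ (true ∷_)) (F′ ∘ (true ∷_)) w) (toH-+ (F ∘ (false ∷_)) (F′ ∘ (false ∷_)) w))
        (sub-interchange (toH (F ∘ (true ∷_)) w) (toH (F′ ∘ (true ∷_)) w)
                         (toH (F ∘ (false ∷_)) w) (toH (F′ ∘ (false ∷_)) w))
  where
  sub-interchange : ∀ a b c d → (a + b) - (c + d) ≡ (a - c) + (b - d)
  sub-interchange = solve-∀

toH-tail : (F : Vec Bool n → ℤ) (w : Vec Bool (suc n)) → toH (F ∘ tail) w ≡ (a· toH F) w
toH-tail F (false ∷ w) = refl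
toH-tail F (true ∷ w) = ℤₚ.+-inverseʳ (toH F w)

toH-·b : (F : Vec Bool n → ℤ) (w : Vec Bool (suc n)) → toH (F ·b) w ≡ (toH F ·b) w
toH-·b {zero} F (false ∷ []) = refl
toH-·b {zero} F (true ∷ []) = ℤₚ.+-identityʳ (F [])
toH-·b {suc n} F (false ∷ w) = toH-·b (F ∘ (false ∷_)) w
toH-·b {suc n} F (true ∷ w) =
  trans (cong₂ _-_ (toH-·b (F ∘ (true ∷_)) w) (toH-·b (F ∘ (false ∷_)) w)) (if-- (last w))
  where
  if-- : ∀ b → (if b then toH (F ∘ (true ∷_)) (init w) else 0ℤ) - (if b then toH (F ∘ (false ∷_)) (init w) else 0ℤ)
             ≡ (if b then toH F (true ∷ init w) else 0ℤ)
  if-- false = refl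
  if-- true = refl

toH-Dbc : (F : Vec Bool n → ℤ) (w : Vec Bool (suc n)) → toH (Dbc F) w ≡ Dba (toH F) w
toH-Dbc {zero} F (false ∷ []) = refl
toH-Dbc {zero} F (true ∷ []) = refl
toH-Dbc {suc n} F (false ∷ y ∷ w) = begin
  toH (Dbc F ∘ (false ∷_)) (y ∷ w)
    ≡⟨ toH-cong (λ { (y ∷ w) → ℤₚ.+-identityˡ _ }) (y ∷ w) ⟩
  toH (Dbc (F ∘ (false ∷_))) (y ∷ w)
    ≡⟨ toH-Dbc (F ∘ (false ∷_)) (y ∷ w) ⟩
  Dba (toH (F ∘ (false ∷_))) (y ∷ w)
    ≡⟨ ℤₚ.+-identityˡ _ ⟨
  Dba (toH F) (false ∷ y ∷ w) ∎
toH-Dbc {suc n} F (true ∷ y ∷ w) = begin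
  toH (Dbc F ∘ (true ∷_)) (y ∷ w) - toH (Dbc F ∘ (false ∷_)) (y ∷ w)
    ≡⟨ cong₂ _-_ first-b first-a ⟩
  ((a· Mt) (y ∷ w) + Dba Mt (y ∷ w)) - Dba Mf (y ∷ w)
    ≡⟨ regroup y ⟩
  (if not y then Mf w + (Mt w - Mf w) else 0ℤ) + (Dba Mt (y ∷ w) - Dba Mf (y ∷ w))
    ≡⟨ cong ((if not y then Mf w + (Mt w - Mf w) else 0ℤ) +_) (sym (Dba-- Mt Mf (y ∷ w))) ⟩
  Dba (toH F) (true ∷ y ∷ w) ∎
  where
  Mt Mf : Vec Bool n → ℤ
  Mt = toH (F ∘ (true ∷_))
  Mf = toH (F ∘ (false ∷_))
  first-a : toH (Dbc F ∘ (false ∷_)) (y ∷ w) ≡ Dba Mf (y ∷ w)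
  first-a = trans (toH-cong (λ { (y ∷ w) → ℤₚ.+-identityˡ _ }) (y ∷ w)) (toH-Dbc (F ∘ (false ∷_)) (y ∷ w))
  first-b : toH (Dbc F ∘ (true ∷_)) (y ∷ w) ≡ (a· Mt) (y ∷ w) + Dba Mt (y ∷ w)
  first-b = begin
    toH (Dbc F ∘ (true ∷_)) (y ∷ w)
      ≡⟨ toH-cong (λ { (y ∷ w) → refl }) (y ∷ w) ⟩
    toH (λ v → F (true ∷ tail v) + Dbc (F ∘ (true ∷_)) v) (y ∷ w)
      ≡⟨ toH-+ ((F ∘ (true ∷_)) ∘ tail) (Dbc (F ∘ (true ∷_))) (y ∷ w) ⟩
    toH ((F ∘ (true ∷_)) ∘ tail) (y ∷ w) + toH (Dbc (F ∘ (true ∷_))) (y ∷ w)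
      ≡⟨ cong₂ _+_ (toH-tail (F ∘ (true ∷_)) (y ∷ w)) (toH-Dbc (F ∘ (true ∷_)) (y ∷ w)) ⟩
    (a· Mt) (y ∷ w) + Dba Mt (y ∷ w) ∎
  regroup : ∀ y → ((a· Mt) (y ∷ w) + Dba Mt (y ∷ w)) - Dba Mf (y ∷ w)
                  ≡ (if not y then Mf w + (Mt w - Mf w) else 0ℤ) + (Dba Mt (y ∷ w) - Dba Mf (y ∷ w))
  regroup false = lemma (Mt w) (Mf w) (Dba Mt (false ∷ w)) (Dba Mf (false ∷ w))
    where
    lemma : ∀ t f d e → (t + d) - e ≡ (f + (t - f)) + (d - e)
    lemma = solve-∀
  regroup true = ℤₚ.+-assoc 0ℤ (Dba Mt (true ∷ w)) (- Dba Mf (true ∷ w))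

toH-c·+·b+Dbc : (F : Vec Bool n → ℤ) (w : Vec Bool (suc n)) →
                    toH (λ v → F (tail v) + (F ·b) v + Dbc F v) w ≡ (a· toH F) w + (toH F ·b) w + Dba (toH F) w
toH-c·+·b+Dbc F w =
  trans (toH-+ (λ v → F (tail v) + (F ·b) v) (Dbc F) w)
        (cong₂ _+_ (trans (toH-+ (F ∘ tail) (F ·b) w) (cong₂ _+_ (toH-tail F w) (toH-·b F w))) (toH-Dbc F w))

init+Gab≡a·+·b+Dba : (P : Vec Bool n → ℤ) (w : Vec Bool (suc n)) →
                     P (init w) + Gab P w ≡ (a· P) w + (P ·b) w + Dba P w
init+Gab≡a·+·b+Dba {zero} P (false ∷ []) = sym (ℤₚ.+-identityʳ (P [] + 0ℤ))
init+Gab≡a·+·b+Dba {zero} P (true ∷ []) = cong (_+ 0ℤ) (sym (ℤₚ.+-identityˡ (P [])))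
init+Gab≡a·+·b+Dba {suc n} P (x ∷ y ∷ w) = begin
  P (x ∷ init (y ∷ w)) + (t + Gab P′ (y ∷ w))
    ≡⟨ x∙yz≈xz∙y (P (x ∷ init (y ∷ w))) t (Gab P′ (y ∷ w)) ⟩
  P′ (init (y ∷ w)) + Gab P′ (y ∷ w) + t
    ≡⟨ cong (_+ t) (init+Gab≡a·+·b+Dba P′ (y ∷ w)) ⟩
  (a· P′) (y ∷ w) + (P′ ·b) (y ∷ w) + Dba P′ (y ∷ w) + t
    ≡⟨ regroup x y ((P′ ·b) (y ∷ w)) (Dba P′ (y ∷ w)) ⟩
  (a· P) (x ∷ y ∷ w) + (P ·b) (x ∷ y ∷ w) + Dba P (x ∷ y ∷ w) ∎
  where
  P′ : Vec Bool n → ℤ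
  P′ = P ∘ (x ∷_)
  t : ℤ
  t = if x xor y then P (y ∷ w) else 0ℤ
  regroup : (x y : Bool) (B D : ℤ) →
            (a· (P ∘ (x ∷_))) (y ∷ w) + B + D + (if x xor y then P (y ∷ w) else 0ℤ)
              ≡ (a· P) (x ∷ y ∷ w) + B + ((if x ∧ not y then P (false ∷ w) + P (true ∷ w) else 0ℤ) + D)
  regroup false false B D = lemma (P (false ∷ w)) B D
    where
    lemma : ∀ p b d → p + b + d + 0ℤ ≡ p + b + (0ℤ + d)
    lemma = solve-∀
  regroup false true B D = lemma (P (true ∷ w)) B D
    where
    lemma : ∀ p b d → 0ℤ + b + d + p ≡ p + b + (0ℤ + d)
    lemma = solve-∀
  regroup true false B D = lemma (P (false ∷ w)) (P (true ∷ w)) B D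
    where
    lemma : ∀ p q b d → q + b + d + p ≡ 0ℤ + b + ((p + q) + d)
    lemma = solve-∀
  regroup true true B D = lemma B D
    where
    lemma : ∀ b d → 0ℤ + b + d + 0ℤ ≡ 0ℤ + b + (0ℤ + d)
    lemma = solve-∀

PsiB-suc : (n : ℕ) (w : Vec Bool (suc n)) → PsiB (suc n) w ≡ PsiB n (init w) + Gab (PsiB n) w
PsiB-suc n w = begin
  PsiB (suc n) w
    ≡⟨ alternatingSum≡toH (ℤ.+_ ∘ flagF (suc n)) w ⟩
  toH (ℤ.+_ ∘ flagF (suc n)) w
    ≡⟨ toH-cong (flagF-suc n) w ⟩
  toH (λ v → F (tail v) + (F ·b) v + Dbc F v) w
    ≡⟨ toH-c·+·b+Dbc F w ⟩
  (a· H) w + (H ·b) w + Dba H w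
    ≡⟨ init+Gab≡a·+·b+Dba H w ⟨
  H (init w) + Gab H w
    ≡⟨ cong₂ _+_ (PsiB≡H (init w)) (Gab-cong PsiB≡H w) ⟨
  PsiB n (init w) + Gab (PsiB n) w ∎
  where
  F H : Vec Bool n → ℤ
  F = ℤ.+_ ∘ flagF n
  H = toH F
  PsiB≡H : PsiB n ≗ H
  PsiB≡H = alternatingSum≡toH F

-- cd-polynomials

-- the ab-coefficients of the cd-polynomial Σ_v X v · v
expand : (CD n → ℤ) → Vec Bool n → ℤ
expand {zero} X [] = X ε
expand {suc zero} X (_ ∷ []) = X (c· ε)
expand {suc (suc n)} X (x ∷ y ∷ w) = expand (X ∘ c·) (y ∷ w) + (if x xor y then expand (X ∘ d·) w else 0ℤ)

sum-expandCoeff : (X : CD n → ℤ) (w : Vec Bool n) →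
                  sumℤ (map (λ v → X v * expandCoeff v w) (allCD n)) ≡ expand X w
sum-expandCoeff {zero} X [] = trans (ℤₚ.+-identityʳ _) (ℤₚ.*-identityʳ (X ε))
sum-expandCoeff {suc zero} X (_ ∷ []) = trans (ℤₚ.+-identityʳ _) (ℤₚ.*-identityʳ (X (c· ε)))
sum-expandCoeff {suc (suc n)} X (x ∷ y ∷ w) = begin
  sumℤ (map term (map c· (allCD (suc n)) ++ map d· (allCD n)))
    ≡⟨ cong sumℤ (map-++ term (map c· (allCD (suc n))) (map d· (allCD n))) ⟩
  sumℤ (map term (map c· (allCD (suc n))) ++ map term (map d· (allCD n)))
    ≡⟨ sumℤ-++ (map term (map c· (allCD (suc n)))) (map term (map d· (allCD n))) ⟩
  sumℤ (map term (map c· (allCD (suc n)))) + sumℤ (map term (map d· (allCD n)))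
    ≡⟨ cong₂ (λ s t → sumℤ s + sumℤ t) (map-∘ (allCD (suc n))) (map-∘ (allCD n)) ⟨
  sumℤ (map (term ∘ c·) (allCD (suc n))) + sumℤ (map (term ∘ d·) (allCD n))
    ≡⟨ cong₂ _+_ (sum-expandCoeff (X ∘ c·) (y ∷ w)) (d-part (x xor y)) ⟩
  expand X (x ∷ y ∷ w) ∎
  where
  term : CD (suc (suc n)) → ℤ
  term v = X v * expandCoeff v (x ∷ y ∷ w)
  d-part : ∀ b → sumℤ (map (λ v → X (d· v) * (if b then expandCoeff v w else 0ℤ)) (allCD n))
                 ≡ (if b then expand (X ∘ d·) w else 0ℤ)
  d-part true = sum-expandCoeff (X ∘ d·) w
  d-part false = trans (cong sumℤ (map-cong (ℤₚ.*-zeroʳ ∘ X ∘ d·) (allCD n))) (sumℤ-zeros (allCD n))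

expand-+ : (X Y : CD n → ℤ) (w : Vec Bool n) → expand (λ v → X v + Y v) w ≡ expand X w + expand Y w
expand-+ {zero} X Y [] = refl
expand-+ {suc zero} X Y (_ ∷ []) = refl
expand-+ {suc (suc n)} X Y (x ∷ y ∷ w) =
  trans (cong₂ _+_ (expand-+ (X ∘ c·) (Y ∘ c·) (y ∷ w)) (head-term (x xor y)))
        (interchange (expand (X ∘ c·) (y ∷ w)) (expand (Y ∘ c·) (y ∷ w))
                     (if x xor y then expand (X ∘ d·) w else 0ℤ) (if x xor y then expand (Y ∘ d·) w else 0ℤ))
  where
  head-term : ∀ b → (if b then expand (λ v → X (d· v) + Y (d· v)) w else 0ℤ)
                ≡ (if b then expand (X ∘ d·) w else 0ℤ) + (if b then expand (Y ∘ d·) w else 0ℤ)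
  head-term true = expand-+ (X ∘ d·) (Y ∘ d·) w
  head-term false = refl

expand-zero : (w : Vec Bool n) → expand (λ _ → 0ℤ) w ≡ 0ℤ
expand-zero {zero} [] = refl
expand-zero {suc zero} (_ ∷ []) = refl
expand-zero {suc (suc n)} (x ∷ y ∷ w) = cong₂ _+_ (expand-zero (y ∷ w)) (head-term (x xor y))
  where
  head-term : ∀ b → (if b then expand {n} (λ _ → 0ℤ) w else 0ℤ) ≡ 0ℤ
  head-term true = expand-zero w
  head-term false = refl

expand-∘c· : {X X′ : CD (suc (suc n)) → ℤ} → expand X ≗ expand X′ → expand (X ∘ c·) ≗ expand (X′ ∘ c·)
expand-∘c· eq (false ∷ w) = trans (sym (ℤₚ.+-identityʳ _)) (trans (eq (false ∷ false ∷ w)) (ℤₚ.+-identityʳ _))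
expand-∘c· eq (true ∷ w) = trans (sym (ℤₚ.+-identityʳ _)) (trans (eq (true ∷ true ∷ w)) (ℤₚ.+-identityʳ _))

expand-injective : {X X′ : CD n → ℤ} → expand X ≗ expand X′ → X ≗ X′
expand-injective {zero} eq ε = eq []
expand-injective {suc zero} eq (c· ε) = eq (false ∷ [])
expand-injective {suc (suc n)} eq (c· v) = expand-injective (expand-∘c· eq) v
expand-injective {suc (suc n)} {X} {X′} eq (d· v) = expand-injective d-part v
  where
  d-part : expand (X ∘ d·) ≗ expand (X′ ∘ d·)
  d-part w = ∙-cancelˡ (expand (X ∘ c·) (false ∷ w)) (expand (X ∘ d·) w) (expand (X′ ∘ d·) w)
               (trans (eq (true ∷ false ∷ w)) (cong (_+ expand (X′ ∘ d·) w) (sym (expand-∘c· eq (false ∷ w)))))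

_·c : (CD n → ℤ) → CD (suc n) → ℤ
_·c {zero} X (c· ε) = X ε
_·c {suc n} X (c· v) = ((X ∘ c·) ·c) v
_·c {suc zero} X (d· ε) = 0ℤ
_·c {suc (suc n)} X (d· v) = ((X ∘ d·) ·c) v

onD : (CD (suc n) → ℤ) → CD (suc n) → ℤ
onD X (c· _) = 0ℤ
onD X (d· v) = X (d· v)

-- the derivation with G c = d and G d = c d
G : (CD n → ℤ) → CD (suc n) → ℤ
G {zero} X (c· ε) = 0ℤ
G {suc n} X (c· v) = G (X ∘ c·) v + onD X v
G {suc zero} X (d· ε) = X (c· ε)
G {suc (suc n)} X (d· v) = X (c· v) + G (X ∘ d·) v

expand-·c : (X : CD n → ℤ) (w : Vec Bool (suc n)) → expand (X ·c) w ≡ expand X (init w)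
expand-·c {zero} X (_ ∷ []) = refl
expand-·c {suc zero} X (x ∷ y ∷ []) = trans (cong (X (c· ε) +_) (if-same (x xor y))) (ℤₚ.+-identityʳ (X (c· ε)))
expand-·c {suc (suc n)} X (x ∷ y ∷ z ∷ w) =
  cong₂ _+_ (expand-·c (X ∘ c·) (y ∷ z ∷ w)) (cong (λ e → if x xor y then e else 0ℤ) (expand-·c (X ∘ d·) (z ∷ w)))

expand-onD : (X : CD (suc (suc n)) → ℤ) (y z : Bool) (w : Vec Bool n) →
             expand (onD X) (y ∷ z ∷ w) ≡ (if y xor z then expand (X ∘ d·) w else 0ℤ)
expand-onD X y z w = trans (cong (_+ (if y xor z then expand (X ∘ d·) w else 0ℤ)) (expand-zero (z ∷ w)))
                           (ℤₚ.+-identityˡ _)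

-- If y ≠ z, then x differs from exactly one of y and z.
xor-split : (x y z : Bool) (D : ℤ) →
  (if y xor z then D else 0ℤ)
    ≡ (if x xor y then (if y xor z then D else 0ℤ) else 0ℤ) + (if y xor z then (if x xor z then D else 0ℤ) else 0ℤ)
xor-split false false false D = refl
xor-split false false true D = sym (ℤₚ.+-identityˡ D)
xor-split false true false D = sym (ℤₚ.+-identityʳ D)
xor-split false true true D = refl
xor-split true false false D = refl
xor-split true false true D = sym (ℤₚ.+-identityʳ D)
xor-split true true false D = sym (ℤₚ.+-identityˡ D)
xor-split true true true D = refl

Gab-expand-∘∷ : (X : CD (suc (suc n)) → ℤ) (x y z : Bool) (w : Vec Bool n) →
  Gab (expand X ∘ (x ∷_)) (y ∷ z ∷ w)
    ≡ Gab (expand (X ∘ c·)) (y ∷ z ∷ w)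
      + ((if y xor z then (if x xor z then expand (X ∘ d·) w else 0ℤ) else 0ℤ)
         + (if x xor y then Gab (expand (X ∘ d·)) (z ∷ w) else 0ℤ))
Gab-expand-∘∷ {n} X x y z w = begin
  Gab (expand X ∘ (x ∷_)) (y ∷ z ∷ w)
    ≡⟨ Gab-cong {P = expand X ∘ (x ∷_)} {Q = λ v → expand (X ∘ c·) v + dTail v}
                (λ { (_ ∷ _) → refl }) (y ∷ z ∷ w) ⟩
  Gab (λ v → expand (X ∘ c·) v + dTail v) (y ∷ z ∷ w)
    ≡⟨ Gab-+ (expand (X ∘ c·)) dTail (y ∷ z ∷ w) ⟩
  Gab (expand (X ∘ c·)) (y ∷ z ∷ w)
    + ((if y xor z then dTail (z ∷ w) else 0ℤ) + Gab (λ v → if x xor y then expand (X ∘ d·) v else 0ℤ) (z ∷ w))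
    ≡⟨ cong (λ g → Gab (expand (X ∘ c·)) (y ∷ z ∷ w) + ((if y xor z then dTail (z ∷ w) else 0ℤ) + g))
            (Gab-if (x xor y) (expand (X ∘ d·)) (z ∷ w)) ⟩
  Gab (expand (X ∘ c·)) (y ∷ z ∷ w)
    + ((if y xor z then (if x xor z then expand (X ∘ d·) w else 0ℤ) else 0ℤ)
       + (if x xor y then Gab (expand (X ∘ d·)) (z ∷ w) else 0ℤ)) ∎
  where
  dTail : Vec Bool (suc n) → ℤ
  dTail (v₁ ∷ v) = if x xor v₁ then expand (X ∘ d·) v else 0ℤ

expand-G : (X : CD n → ℤ) (w : Vec Bool (suc n)) → expand (G X) w ≡ Gab (expand X) w
expand-G {zero} X (_ ∷ []) = refl
expand-G {suc zero} X (x ∷ y ∷ []) = ℤₚ.+-comm 0ℤ (if x xor y then X (c· ε) else 0ℤ)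
expand-G {suc (suc k)} X (x ∷ y ∷ z ∷ w) = begin
  expand (G X ∘ c·) (y ∷ z ∷ w) + (if x xor y then expand (G X ∘ d·) (z ∷ w) else 0ℤ)
    ≡⟨ cong₂ _+_ (expand-+ (G (X ∘ c·)) (onD X) (y ∷ z ∷ w))
                 (cong (λ e → if x xor y then e else 0ℤ) (expand-+ (X ∘ c·) (G (X ∘ d·)) (z ∷ w))) ⟩
  expand (G (X ∘ c·)) (y ∷ z ∷ w) + expand (onD X) (y ∷ z ∷ w)
    + (if x xor y then Ec + expand (G (X ∘ d·)) (z ∷ w) else 0ℤ)
    ≡⟨ cong₂ (λ g h → g + expand (onD X) (y ∷ z ∷ w) + (if x xor y then Ec + h else 0ℤ))
             (expand-G (X ∘ c·) (y ∷ z ∷ w)) (expand-G (X ∘ d·) (z ∷ w)) ⟩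
  Gc + expand (onD X) (y ∷ z ∷ w) + (if x xor y then Ec + Gd else 0ℤ)
    ≡⟨ cong₂ (λ r t → Gc + r + t) (expand-onD X y z w) (if-+ (x xor y) Ec Gd) ⟩
  Gc + R + (Ecx + Gdx)
    ≡⟨ cong (λ r → Gc + r + (Ecx + Gdx)) (xor-split x y z Ed) ⟩
  Gc + (R₁ + R₂) + (Ecx + Gdx)
    ≡⟨ rearrange Gc R₁ R₂ Ecx Gdx ⟩
  Ecx + R₁ + (Gc + (R₂ + Gdx))
    ≡⟨ cong₂ _+_ (if-+ (x xor y) Ec R) (Gab-expand-∘∷ X x y z w) ⟨
  Gab (expand X) (x ∷ y ∷ z ∷ w) ∎
  where
  Gc Ec Ed Gd R R₁ R₂ Ecx Gdx : ℤ
  Gc = Gab (expand (X ∘ c·)) (y ∷ z ∷ w)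
  Ec = expand (X ∘ c·) (z ∷ w)
  Ed = expand (X ∘ d·) w
  Gd = Gab (expand (X ∘ d·)) (z ∷ w)
  R = if y xor z then Ed else 0ℤ
  R₁ = if x xor y then R else 0ℤ
  R₂ = if y xor z then (if x xor z then Ed else 0ℤ) else 0ℤ
  Ecx = if x xor y then Ec else 0ℤ
  Gdx = if x xor y then Gd else 0ℤ
  rearrange : ∀ a r₁ r₂ b g → a + (r₁ + r₂) + (b + g) ≡ b + r₁ + (a + (r₂ + g))
  rearrange = solve-∀

expand≗PsiB : (X : CD n → ℤ) → IsCdIndexB n X → expand X ≗ PsiB n
expand≗PsiB X isCd w = trans (sym (sum-expandCoeff X w)) (isCd w)

cdIndexB-suc : (X : CD n → ℤ) (Y : CD (suc n) → ℤ) → IsCdIndexB n X → IsCdIndexB (suc n) Y →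
               Y ≗ λ v → (X ·c) v + G X v
cdIndexB-suc {n} X Y isX isY = expand-injective λ w → begin
  expand Y w
    ≡⟨ expand≗PsiB Y isY w ⟩
  PsiB (suc n) w
    ≡⟨ PsiB-suc n w ⟩
  PsiB n (init w) + Gab (PsiB n) w
    ≡⟨ cong₂ _+_ (expand≗PsiB X isX (init w)) (Gab-cong (expand≗PsiB X isX) w) ⟨
  expand X (init w) + Gab (expand X) w
    ≡⟨ cong₂ _+_ (expand-·c X w) (expand-G X w) ⟨
  expand (X ·c) w + expand (G X) w
    ≡⟨ expand-+ (X ·c) (G X) w ⟨
  expand (λ v → (X ·c) v + G X v) w ∎

-- Words as lists

Family : Set
Family = (n : ℕ) → CD n → ℤ

after-c : Family → Family
after-c Y n v = Y (suc n) (c· v)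

after-d : Family → Family
after-d Y n v = Y (suc (suc n)) (d· v)

next : Family → Σ ℕ CD → ℤ
next Y (zero , _) = 0ℤ
next Y (suc n , v) = (Y n ·c) v + G (Y n) v

-- the part of next Y (c· v) not coming from after-c Y: the final c when v is empty, and c d in G d
-- when v begins with d
cExtra : Family → Σ ℕ CD → ℤ
cExtra Y (zero , ε) = Y 0 ε
cExtra Y (suc n , v) = onD (Y (suc n)) v

next-c· : (Y : Family) (W : Σ ℕ CD) → next Y (suc (proj₁ W) , c· (proj₂ W)) ≡ next (after-c Y) W + cExtra Y W
next-c· Y (zero , ε) = ℤₚ.+-comm (Y 0 ε) 0ℤ
next-c· Y (suc n , v) = sym (ℤₚ.+-assoc ((after-c Y n ·c) v) (G (after-c Y n) v) (onD (Y (suc n)) v))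

next-d· : (Y : Family) (W : Σ ℕ CD) →
          next Y (suc (suc (proj₁ W)) , d· (proj₂ W)) ≡ Y (suc (proj₁ W)) (c· (proj₂ W)) + next (after-d Y) W
next-d· Y (zero , ε) = ℤₚ.+-comm 0ℤ (Y 1 (c· ε))
next-d· Y (suc n , v) = x∙yz≈y∙xz ((after-d Y n ·c) v) (Y (suc (suc n)) (c· v)) (G (after-d Y n) v)

wordOf-suc : (m : ℕ) (ms : List ℕ) → wordOf (suc m) ms ≡ (suc (proj₁ (wordOf m ms)) , c· (proj₂ (wordOf m ms)))
wordOf-suc m [] = refl
wordOf-suc m (_ ∷ _) = refl

incr : List ℕ → List ℕ
incr [] = []
incr (a ∷ t) = suc a ∷ t

-- Sop (m ∷ ms) for m ∷ ms ≠ 0 ∷ []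
Sterms : ℕ → List ℕ → List (List ℕ)
Sterms m ms = decs (m ∷ ms) ++ merges (m ∷ ms)

merges-incr : (a : ℕ) (ms : List ℕ) → map incr (merges (a ∷ ms)) ≡ merges (suc a ∷ ms)
merges-incr a [] = refl
merges-incr a (m′ ∷ ms) = cong ((suc (a ℕ.+ m′ ℕ.+ 1) ∷ ms) ∷_) (sym (map-∘ (merges (m′ ∷ ms))))

Sterms-one : (ms : List ℕ) → Sterms 1 ms ≡ (0 ∷ ms) ∷ map incr (Sterms 0 ms)
Sterms-one ms = cong ((0 ∷ ms) ∷_) (sym (trans (map-++ incr (decs (0 ∷ ms)) (merges (0 ∷ ms)))
                                               (cong₂ _++_ (sym (map-∘ (decs ms))) (merges-incr 0 ms))))

Sterms-suc-suc : (m : ℕ) (ms : List ℕ) → Sterms (suc (suc m)) ms ≡ map incr (Sterms (suc m) ms)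
Sterms-suc-suc m ms =
  cong ((suc m ∷ ms) ∷_) (sym (trans (map-++ incr (map (suc m ∷_) (decs ms)) (merges (suc m ∷ ms)))
                                     (cong₂ _++_ (sym (map-∘ (decs ms))) (merges-incr (suc m) ms))))

-- S never produces e = [].
map-Sterms-cong : {f g : List ℕ → ℤ} → (∀ a t → f (a ∷ t) ≡ g (a ∷ t)) →
                  (m : ℕ) (ms : List ℕ) → map f (Sterms m ms) ≡ map g (Sterms m ms)
map-Sterms-cong {f} {g} f≡g m ms = begin
  map f (decs (m ∷ ms) ++ merges (m ∷ ms))
    ≡⟨ map-++ f (decs (m ∷ ms)) (merges (m ∷ ms)) ⟩
  map f (decs (m ∷ ms)) ++ map f (merges (m ∷ ms))
    ≡⟨ cong₂ _++_ (on-decs m ms) (on-merges m ms) ⟩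
  map g (decs (m ∷ ms)) ++ map g (merges (m ∷ ms))
    ≡⟨ map-++ g (decs (m ∷ ms)) (merges (m ∷ ms)) ⟨
  map g (decs (m ∷ ms) ++ merges (m ∷ ms)) ∎
  where
  on-prefixed : ∀ a L → map f (map (a ∷_) L) ≡ map g (map (a ∷_) L)
  on-prefixed a L = trans (sym (map-∘ L)) (trans (map-cong (f≡g a) L) (map-∘ L))
  on-decs : ∀ m ms → map f (decs (m ∷ ms)) ≡ map g (decs (m ∷ ms))
  on-decs zero ms = on-prefixed 0 (decs ms)
  on-decs (suc m) ms = cong₂ _∷_ (f≡g m ms) (on-prefixed (suc m) (decs ms))
  on-merges : ∀ m ms → map f (merges (m ∷ ms)) ≡ map g (merges (m ∷ ms))
  on-merges m [] = refl
  on-merges m (m′ ∷ ms) = cong₂ _∷_ (f≡g (m ℕ.+ m′ ℕ.+ 1) ms) (on-prefixed m (merges (m′ ∷ ms)))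

βsum-++ : (Y : Family) (xs ys : List (List ℕ)) → βsum Y (xs ++ ys) ≡ βsum Y xs + βsum Y ys
βsum-++ Y xs ys = trans (cong sumℤ (map-++ (β Y) xs ys)) (sumℤ-++ (map (β Y) xs) (map (β Y) ys))

βsum-after-c : (Y : Family) (us : List (List ℕ)) → βsum (after-c Y) us ≡ βsum Y (map incr us)
βsum-after-c Y us = cong sumℤ (trans (map-cong β-after-c us) (map-∘ us))
  where
  β-after-c : ∀ u → β (after-c Y) u ≡ β Y (incr u)
  β-after-c [] = refl
  β-after-c (a ∷ t) = cong (uncurry Y) (sym (wordOf-suc a t))

βsum-after-d : (Y : Family) (m : ℕ) (ms : List ℕ) →
               βsum (after-d Y) (Sterms m ms) ≡ βsum Y (map (0 ∷_) (Sterms m ms))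
βsum-after-d Y m ms = cong sumℤ (trans (map-Sterms-cong (λ a t → refl) m ms) (map-∘ (Sterms m ms)))

βsum-Sterms-zero : (Y : Family) (m′ : ℕ) (ms : List ℕ) →
                   βsum Y (Sterms 0 (m′ ∷ ms)) ≡ β Y (suc m′ ∷ ms) + βsum Y (map (0 ∷_) (Sterms m′ ms))
βsum-Sterms-zero Y m′ ms = begin
  βsum Y (map (0 ∷_) D ++ (m′ ℕ.+ 1 ∷ ms) ∷ map (0 ∷_) M)
    ≡⟨ βsum-++ Y (map (0 ∷_) D) ((m′ ℕ.+ 1 ∷ ms) ∷ map (0 ∷_) M) ⟩
  βsum Y (map (0 ∷_) D) + (β Y (m′ ℕ.+ 1 ∷ ms) + βsum Y (map (0 ∷_) M))
    ≡⟨ cong (λ k → βsum Y (map (0 ∷_) D) + (β Y (k ∷ ms) + βsum Y (map (0 ∷_) M))) (ℕₚ.+-comm m′ 1) ⟩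
  βsum Y (map (0 ∷_) D) + (β Y (suc m′ ∷ ms) + βsum Y (map (0 ∷_) M))
    ≡⟨ x∙yz≈y∙xz (βsum Y (map (0 ∷_) D)) (β Y (suc m′ ∷ ms)) (βsum Y (map (0 ∷_) M)) ⟩
  β Y (suc m′ ∷ ms) + (βsum Y (map (0 ∷_) D) + βsum Y (map (0 ∷_) M))
    ≡⟨ cong (β Y (suc m′ ∷ ms) +_)
            (trans (cong (βsum Y) (map-++ (0 ∷_) D M)) (βsum-++ Y (map (0 ∷_) D) (map (0 ∷_) M))) ⟨
  β Y (suc m′ ∷ ms) + βsum Y (map (0 ∷_) (Sterms m′ ms)) ∎
  where
  D M : List (List ℕ)
  D = decs (m′ ∷ ms)
  M = merges (m′ ∷ ms)

βsum-Sterms-suc : (Y : Family) (m : ℕ) (ms : List ℕ) →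
                  βsum Y (map incr (Sterms m ms)) + cExtra Y (wordOf m ms) ≡ βsum Y (Sterms (suc m) ms)
βsum-Sterms-suc Y zero ms = begin
  βsum Y (map incr (Sterms 0 ms)) + cExtra Y (wordOf 0 ms)
    ≡⟨ cong (βsum Y (map incr (Sterms 0 ms)) +_) (cExtra-zero ms) ⟩
  βsum Y (map incr (Sterms 0 ms)) + β Y (0 ∷ ms)
    ≡⟨ ℤₚ.+-comm (βsum Y (map incr (Sterms 0 ms))) (β Y (0 ∷ ms)) ⟩
  β Y (0 ∷ ms) + βsum Y (map incr (Sterms 0 ms))
    ≡⟨ cong (βsum Y) (Sterms-one ms) ⟨
  βsum Y (Sterms 1 ms) ∎
  where
  cExtra-zero : ∀ ms → cExtra Y (wordOf 0 ms) ≡ β Y (0 ∷ ms)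
  cExtra-zero [] = refl
  cExtra-zero (_ ∷ _) = refl
βsum-Sterms-suc Y (suc m) ms =
  trans (cong₂ _+_ (cong (βsum Y) (sym (Sterms-suc-suc m ms))) (cExtra-suc ms)) (ℤₚ.+-identityʳ _)
  where
  cExtra-suc : ∀ ms → cExtra Y (wordOf (suc m) ms) ≡ 0ℤ
  cExtra-suc [] = refl
  cExtra-suc (_ ∷ _) = refl

next-wordOf : (Y : Family) (m : ℕ) (ms : List ℕ) → next Y (wordOf m ms) ≡ βsum Y (Sterms m ms)
next-wordOf Y zero [] = refl
next-wordOf Y zero (m′ ∷ ms) = begin
  next Y (suc (suc (proj₁ W)) , d· (proj₂ W))
    ≡⟨ next-d· Y W ⟩
  uncurry Y (suc (proj₁ W) , c· (proj₂ W)) + next (after-d Y) W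
    ≡⟨ cong₂ _+_ (cong (uncurry Y) (sym (wordOf-suc m′ ms))) (next-wordOf (after-d Y) m′ ms) ⟩
  β Y (suc m′ ∷ ms) + βsum (after-d Y) (Sterms m′ ms)
    ≡⟨ cong (β Y (suc m′ ∷ ms) +_) (βsum-after-d Y m′ ms) ⟩
  β Y (suc m′ ∷ ms) + βsum Y (map (0 ∷_) (Sterms m′ ms))
    ≡⟨ βsum-Sterms-zero Y m′ ms ⟨
  βsum Y (Sterms 0 (m′ ∷ ms)) ∎
  where
  W : Σ ℕ CD
  W = wordOf m′ ms
next-wordOf Y (suc m) ms = begin
  next Y (wordOf (suc m) ms)
    ≡⟨ cong (next Y) (wordOf-suc m ms) ⟩
  next Y (suc (proj₁ W) , c· (proj₂ W))
    ≡⟨ next-c· Y W ⟩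
  next (after-c Y) W + cExtra Y W
    ≡⟨ cong (_+ cExtra Y W) (trans (next-wordOf (after-c Y) m ms) (βsum-after-c Y (Sterms m ms))) ⟩
  βsum Y (map incr (Sterms m ms)) + cExtra Y W
    ≡⟨ βsum-Sterms-suc Y m ms ⟩
  βsum Y (Sterms (suc m) ms) ∎
  where
  W : Σ ℕ CD
  W = wordOf m ms

lemma3p3 : (Φ : (n : ℕ) → CD n → ℤ) → ((n : ℕ) → IsCdIndexB n (Φ n)) →
    (m : ℕ) (ms : List ℕ) → βsum Φ (Sop (m ∷ ms)) ≡ β Φ (m ∷ ms)
lemma3p3 Φ isCd zero [] = sym (expand≗PsiB (Φ 0) (isCd 0) [])
lemma3p3 Φ isCd zero (m′ ∷ ms) = begin
  βsum Φ (Sterms 0 (m′ ∷ ms))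
    ≡⟨ next-wordOf Φ 0 (m′ ∷ ms) ⟨
  next Φ (wordOf 0 (m′ ∷ ms))
    ≡⟨ cdIndexB-suc (Φ (suc d)) (Φ (suc (suc d))) (isCd (suc d)) (isCd (suc (suc d))) (d· v) ⟨
  β Φ (0 ∷ m′ ∷ ms) ∎
  where
  d : ℕ
  d = proj₁ (wordOf m′ ms)
  v : CD d
  v = proj₂ (wordOf m′ ms)
lemma3p3 Φ isCd (suc m) ms = begin
  βsum Φ (Sterms (suc m) ms)
    ≡⟨ next-wordOf Φ (suc m) ms ⟨
  next Φ (wordOf (suc m) ms)
    ≡⟨ cong (next Φ) (wordOf-suc m ms) ⟩
  next Φ (suc d , c· v)
    ≡⟨ cdIndexB-suc (Φ d) (Φ (suc d)) (isCd d) (isCd (suc d)) (c· v) ⟨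
  Φ (suc d) (c· v)
    ≡⟨ cong (uncurry Φ) (wordOf-suc m ms) ⟨
  β Φ (suc m ∷ ms) ∎
  where
  d : ℕ
  d = proj₁ (wordOf m ms)
  v : CD d
  v = proj₂ (wordOf m ms)
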